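{- Let $G$ be a $3$-e.c. graph with vertex set $V$, and let $x,y$ be two distinct vertices with neighbourhoods $N(x)$ and $N(y)$. Then every vertex in $V\setminus(N(x)\cup N(y)\cup\{x,y\})$ is adjacent to at least one vertex of $N(x)\cap N(y)$.
   Context: A graph with vertex set $V$ is $n$-e.c. if for every pair of disjoint subsets $A,B\subseteq V$ with $|A\cup B|=n$ (either may be empty) there is a vertex $z\notin A\cup B$ adjacent to every vertex of $A$ and to no vertex of $B$. -}

module Defs where

open import Level using (Level; suc; _⊔_)
open import Data.Nat using (ℕ; _+_)
open import Data.List using (List; length)
open import Data.List.Relation.Unary.All using (All)
open import Data.List.Relation.Unary.Unique.Propositional using (Unique)
open import Data.List.Membership.Propositional using (_∈_; _∉_)
open import Data.Product using (Σ; _×_; ∃)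
open import Relation.Nullary using (¬_)
open import Relation.Binary.PropositionalEquality using (_≡_)

record Graph (a ℓ : Level) : Set (suc (a ⊔ ℓ)) where
  field
    V      : Set a
    Adj    : V → V → Set ℓ
    sym    : ∀ {u v} → Adj u v → Adj v u
    irrefl : ∀ {u} → ¬ Adj u u

IsNEC : ∀ {a ℓ} → ℕ → Graph a ℓ → Set (a ⊔ ℓ)
IsNEC n G =
  (A B : List V) → Unique A → Unique B →
  (∀ {v} → v ∈ A → v ∉ B) →
  length A + length B ≡ n →
  Σ V λ z → z ∉ A × z ∉ B × All (Adj z) A × All (λ b → ¬ Adj z b) B
  where open Graph G

module Submission where

open import Defs
open import Data.List using (List; []; _∷_; length)
open import Data.List.Relation.Unary.All using (All; []; _∷_)
open import Data.List.Relation.Unary.AllPairs using ([]; _∷_)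
open import Data.List.Relation.Unary.Unique.Propositional using (Unique)
open import Data.Nat.Properties using (+-identityʳ)
open import Data.Product using (Σ; _×_; _,_)
open import Relation.Nullary using (¬_)
open import Relation.Binary.PropositionalEquality using (_≡_; refl; sym; trans)

common-neighbour : ∀ {a ℓ} {n} (G : Graph a ℓ) → IsNEC n G →
  (A : List (Graph.V G)) → Unique A → length A ≡ n →
  Σ (Graph.V G) λ z → All (Graph.Adj G z) A
common-neighbour G nec A unique-A |A|≡n
  with nec A [] unique-A [] (λ _ ()) (trans (+-identityʳ (length A)) |A|≡n)
... | z , _ , _ , adj-A , _ = z , adj-A

mainTheorem5 : ∀ {a ℓ} (G : Graph a ℓ) → IsNEC 3 G →
    (x y : Graph.V G) → ¬ x ≡ y →
    (w : Graph.V G) → ¬ w ≡ x → ¬ w ≡ y →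
    ¬ Graph.Adj G x w → ¬ Graph.Adj G y w →
    Σ (Graph.V G) λ u → Graph.Adj G x u × Graph.Adj G y u × Graph.Adj G w u
mainTheorem5 G nec x y x≢y w w≢x w≢y _ _
  with common-neighbour G nec (x ∷ y ∷ w ∷ []) distinct refl
  where
  distinct : Unique (x ∷ y ∷ w ∷ [])
  distinct = (x≢y ∷ (λ x≡w → w≢x (sym x≡w)) ∷ [])
           ∷ ((λ y≡w → w≢y (sym y≡w)) ∷ [])
           ∷ []
           ∷ []
... | z , zx ∷ zy ∷ zw ∷ [] = z , Graph.sym G zx , Graph.sym G zy , Graph.sym G zw
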